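{- Let $n$ and $k$ be positive integers with $n\geq 2k$, and let $d=\gcd(n,k)$. If $\frac{n}{d}\in\{2,5\}$, then $\chi'_s(GP(n,k))\leq 5$.
   Context: For integers $n,k$ with $n\geq 2k\geq 2$, the generalized Petersen graph $GP(n,k)$ is the simple graph with vertex set $\{u_0,\ldots,u_{n-1}\}\cup\{v_0,\ldots,v_{n-1}\}$ and edge set $\{u_iu_{i+1}:0\le i\le n-1\}\cup\{v_iv_{i+k}:0\le i\le n-1\}\cup\{u_iv_i:0\le i\le n-1\}$, indices taken modulo $n$. A $k$-star edge coloring of a graph is a proper edge coloring using at most $k$ colors such that no path and no cycle with four edges is bicolored (i.e. colored with only two colors). The star chromatic index $\chi'_s(G)$ is the smallest $k$ such that $G$ admits a $k$-star edge coloring. -}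

module Defs where

open import Data.Nat using (ℕ; _+_)
open import Data.Fin using (Fin; toℕ)
open import Data.Bool using (Bool; true; false)
open import Data.Product using (Σ; _×_; ∃-syntax)
open import Data.Sum using (_⊎_)
open import Relation.Binary.PropositionalEquality using (_≡_; _≢_)
open import Relation.Nullary using (¬_)

record Graph : Set₁ where
  field
    V   : Set
    Adj : V → V → Set
open Graph public

-- Generalized Petersen graph GP(n,k)
-- vertex (false , i) is u_i, vertex (true , i) is v_i

-- j ≡ i + s (mod n), for i , j < n and s ≤ n
StepMod : (n : ℕ) → Fin n → ℕ → Fin n → Set
StepMod n i s j = (toℕ i + s ≡ toℕ j) ⊎ (toℕ i + s ≡ toℕ j + n)

GPAdj : (n k : ℕ) → Bool × Fin n → Bool × Fin n → Set
GPAdj n k (false Data.Product., i) (false Data.Product., j) = StepMod n i 1 j ⊎ StepMod n j 1 i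
GPAdj n k (true  Data.Product., i) (true  Data.Product., j) = StepMod n i k j ⊎ StepMod n j k i
GPAdj n k (false Data.Product., i) (true  Data.Product., j) = i ≡ j
GPAdj n k (true  Data.Product., i) (false Data.Product., j) = i ≡ j

GP : ℕ → ℕ → Graph
GP n k = record { V = Bool × Fin n ; Adj = GPAdj n k }

-- Edge colorings with at most m colors: a color c x y for every ordered
-- pair, required to be symmetric on edges (so it is a function of the edge).

module _ (G : Graph) {m : ℕ} (c : V G → V G → Fin m) where

  Symmetric : Set
  Symmetric = ∀ x y → Adj G x y → c x y ≡ c y x

  Proper : Set
  Proper = ∀ x y z → Adj G x y → Adj G x z → y ≢ z → c x y ≢ c x z

  Bicolored4 : V G → V G → V G → V G → V G → Set
  Bicolored4 x0 x1 x2 x3 x4 = ∃[ a ] ∃[ b ]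
    (Two a b (c x0 x1) × Two a b (c x1 x2) × Two a b (c x2 x3) × Two a b (c x3 x4))
    where
    Two : Fin m → Fin m → Fin m → Set
    Two a b e = e ≡ a ⊎ e ≡ b

  Path4 : V G → V G → V G → V G → V G → Set
  Path4 x0 x1 x2 x3 x4 =
    Adj G x0 x1 × Adj G x1 x2 × Adj G x2 x3 × Adj G x3 x4 ×
    x0 ≢ x1 × x0 ≢ x2 × x0 ≢ x3 × x0 ≢ x4 ×
    x1 ≢ x2 × x1 ≢ x3 × x1 ≢ x4 ×
    x2 ≢ x3 × x2 ≢ x4 ×
    x3 ≢ x4

  Cycle4 : V G → V G → V G → V G → Set
  Cycle4 x0 x1 x2 x3 =
    Adj G x0 x1 × Adj G x1 x2 × Adj G x2 x3 × Adj G x3 x0 ×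
    x0 ≢ x1 × x0 ≢ x2 × x0 ≢ x3 ×
    x1 ≢ x2 × x1 ≢ x3 ×
    x2 ≢ x3

  IsStarEdgeColoring : Set
  IsStarEdgeColoring =
    Symmetric × Proper ×
    (∀ x0 x1 x2 x3 x4 → Path4 x0 x1 x2 x3 x4 → ¬ Bicolored4 x0 x1 x2 x3 x4) ×
    (∀ x0 x1 x2 x3 → Cycle4 x0 x1 x2 x3 → ¬ Bicolored4 x0 x1 x2 x3 x0)

-- G admits an m-star edge coloring; χ'_s(G) ≤ m iff this holds
-- (an m-star edge coloring uses *at most* m colors, i.e. colors in Fin m)
StarEdgeColorable : Graph → ℕ → Set
StarEdgeColorable G m = Σ (V G → V G → Fin m) (λ c → IsStarEdgeColoring G c)

{-# OPTIONS --safe #-}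
module Submission where

-- Write d = gcd n k, so that n = q d and k = s d with (q , s) one of (2 , 1), (5 , 1), (5 , 2),
-- and d = 3 a + L with L ∈ {1, 2, 3}.  Cut the rim into q blocks of d consecutive vertices and
-- give position r of a block the r-th symbol of the word (0 1 2)^a 0 3 4 … (L + 1).  Sending u_i
-- and v_i to (side, symbol of the position of i, block of i) maps GP(n, k) onto a finite graph
-- depending only on (q , s , L); an edge of GP(n, k) gets the color of its image under a fixed
-- 5-coloring of that graph.  A bicolored path or 4-cycle of a proper coloring is a
-- non-backtracking 4-walk whose colors alternate, and the image of such a walk is determined by
-- the local pictures ("views") of its three middle vertices.  There are finitely many views, so
-- properness and the absence of alternating walks reduce to a finite check, done by evaluation in
-- each of the nine cases (q , s , L).

open import Defs
open import Data.Bool as Bool using (Bool; true; false; not; _∧_; _∨_; if_then_else_)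
open import Data.Empty using (⊥; ⊥-elim)
open import Data.Fin as Fin using (Fin; toℕ; fromℕ<; #_)
open import Data.Fin.Properties using (toℕ<n; toℕ-injective; toℕ-fromℕ<; all?)
open import Data.List using (List; []; _∷_; map; _++_)
open import Data.List.Membership.Propositional using (_∈_)
open import Data.List.Relation.Unary.All as All using (All)
open import Data.List.Relation.Unary.Any using (here; there)
open import Data.Nat
  using (ℕ; zero; suc; pred; _+_; _*_; _∸_; _≤_; _<_; _≤?_; _≡ᵇ_; _%_; _/_; z≤n; s≤s;
         NonZero; >-nonZero; >-nonZero⁻¹)
open import Data.Nat.DivMod
open import Data.Nat.Divisibility using (divides)
open import Data.Nat.GCD using (gcd; gcd[m,n]∣n)
open import Data.Nat.Properties
open import Data.Nat.Tactic.RingSolver using (solve-∀)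
open import Data.Product using (_×_; _,_; proj₁; proj₂; ∃-syntax)
open import Data.Product.Properties using (≡-dec)
open import Data.Sum using (_⊎_; inj₁; inj₂)
open import Data.Unit using (tt)
open import Function using (_∘′_)
open import Relation.Binary.Definitions using (DecidableEquality)
open import Relation.Binary.PropositionalEquality
open import Relation.Nullary using (¬_; contradiction; Dec; yes; no; _×-dec_; _⊎-dec_; _→-dec_; ¬?)
open import Relation.Nullary.Decidable using (map′; True; toWitness; toWitnessFalse)

-- Star colorings via alternating walks

Alternates : {A : Set} → A → A → A → A → Set
Alternates c₀ c₁ c₂ c₃ = c₀ ≡ c₂ × c₁ ≡ c₃

two-values-alternate : {A : Set} {a b x y z : A} →
  x ≡ a ⊎ x ≡ b → y ≡ a ⊎ y ≡ b → z ≡ a ⊎ z ≡ b → x ≢ y → y ≢ z → x ≡ z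
two-values-alternate (inj₁ refl) (inj₁ refl) _           x≢y _   = ⊥-elim (x≢y refl)
two-values-alternate (inj₂ refl) (inj₂ refl) _           x≢y _   = ⊥-elim (x≢y refl)
two-values-alternate _           (inj₁ refl) (inj₁ refl) _   y≢z = ⊥-elim (y≢z refl)
two-values-alternate _           (inj₂ refl) (inj₂ refl) _   y≢z = ⊥-elim (y≢z refl)
two-values-alternate (inj₁ refl) (inj₂ _)    (inj₁ refl) _   _   = refl
two-values-alternate (inj₂ refl) (inj₁ _)    (inj₂ refl) _   _   = refl

module _ (G : Graph) {m : ℕ} (c : V G → V G → Fin m) where

  NonBacktracking : V G → V G → V G → V G → V G → Set
  NonBacktracking x₀ x₁ x₂ x₃ x₄ =
    Adj G x₀ x₁ × Adj G x₁ x₂ × Adj G x₂ x₃ × Adj G x₃ x₄ × x₀ ≢ x₂ × x₁ ≢ x₃ × x₂ ≢ x₄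

  NoAlternatingWalk : Set
  NoAlternatingWalk = ∀ x₀ x₁ x₂ x₃ x₄ → NonBacktracking x₀ x₁ x₂ x₃ x₄ →
                      ¬ Alternates (c x₀ x₁) (c x₁ x₂) (c x₂ x₃) (c x₃ x₄)

  star-if-no-alternating-walk : (∀ x y → Adj G x y → Adj G y x) →
    Symmetric G c → Proper G c → NoAlternatingWalk → IsStarEdgeColoring G c
  star-if-no-alternating-walk adj-sym symmetric proper no-alternation =
    symmetric , proper , no-bicolored-path , no-bicolored-cycle
    where
    consecutive-differ : ∀ {x₀ x₁ x₂} → Adj G x₀ x₁ → Adj G x₁ x₂ → x₀ ≢ x₂ → c x₀ x₁ ≢ c x₁ x₂
    consecutive-differ {x₀} {x₁} {x₂} a₀₁ a₁₂ x₀≢x₂ eq =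
      proper x₁ x₀ x₂ (adj-sym x₀ x₁ a₀₁) a₁₂ x₀≢x₂ (trans (sym (symmetric x₀ x₁ a₀₁)) eq)

    bicolored-alternates : ∀ {x₀ x₁ x₂ x₃ x₄} → NonBacktracking x₀ x₁ x₂ x₃ x₄ →
      Bicolored4 G c x₀ x₁ x₂ x₃ x₄ → Alternates (c x₀ x₁) (c x₁ x₂) (c x₂ x₃) (c x₃ x₄)
    bicolored-alternates (a₀₁ , a₁₂ , a₂₃ , a₃₄ , x₀≢x₂ , x₁≢x₃ , x₂≢x₄)
                         (_ , _ , i₀ , i₁ , i₂ , i₃) =
      two-values-alternate i₀ i₁ i₂ (consecutive-differ a₀₁ a₁₂ x₀≢x₂) (consecutive-differ a₁₂ a₂₃ x₁≢x₃) ,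
      two-values-alternate i₁ i₂ i₃ (consecutive-differ a₁₂ a₂₃ x₁≢x₃) (consecutive-differ a₂₃ a₃₄ x₂≢x₄)

    no-bicolored-path : ∀ x₀ x₁ x₂ x₃ x₄ → Path4 G c x₀ x₁ x₂ x₃ x₄ →
                        ¬ Bicolored4 G c x₀ x₁ x₂ x₃ x₄
    no-bicolored-path x₀ x₁ x₂ x₃ x₄
      (a₀₁ , a₁₂ , a₂₃ , a₃₄ , _ , x₀≢x₂ , _ , _ , _ , x₁≢x₃ , _ , _ , x₂≢x₄ , _) =
      no-alternation x₀ x₁ x₂ x₃ x₄ walk ∘′ bicolored-alternates walk
      where walk = a₀₁ , a₁₂ , a₂₃ , a₃₄ , x₀≢x₂ , x₁≢x₃ , x₂≢x₄

    no-bicolored-cycle : ∀ x₀ x₁ x₂ x₃ → Cycle4 G c x₀ x₁ x₂ x₃ →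
                         ¬ Bicolored4 G c x₀ x₁ x₂ x₃ x₀
    no-bicolored-cycle x₀ x₁ x₂ x₃ (a₀₁ , a₁₂ , a₂₃ , a₃₀ , _ , x₀≢x₂ , _ , _ , x₁≢x₃ , _) =
      no-alternation x₀ x₁ x₂ x₃ x₀ walk ∘′ bicolored-alternates walk
      where walk = a₀₁ , a₁₂ , a₂₃ , a₃₀ , x₀≢x₂ , x₁≢x₃ , x₀≢x₂ ∘′ sym

-- Adjacency in GP(n, k) as arithmetic modulo n

GPAdj-sym : ∀ {n k} x y → GPAdj n k x y → GPAdj n k y x
GPAdj-sym (false , i) (false , j) (inj₁ p) = inj₂ p
GPAdj-sym (false , i) (false , j) (inj₂ p) = inj₁ p
GPAdj-sym (true  , i) (true  , j) (inj₁ p) = inj₂ p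
GPAdj-sym (true  , i) (true  , j) (inj₂ p) = inj₁ p
GPAdj-sym (false , i) (true  , j) i≡j      = sym i≡j
GPAdj-sym (true  , i) (false , j) i≡j      = sym i≡j

module _ {n : ℕ} .{{_ : NonZero n}} where
  open ≡-Reasoning

  stepMod-forward : ∀ {m} (i j : Fin n) → StepMod n i m j → toℕ j ≡ (toℕ i + m) % n
  stepMod-forward {m} i j (inj₁ eq) = begin
    toℕ j            ≡⟨ m<n⇒m%n≡m (toℕ<n j) ⟨
    toℕ j % n        ≡⟨ cong (_% n) eq ⟨
    (toℕ i + m) % n  ∎
  stepMod-forward {m} i j (inj₂ eq) = begin
    toℕ j            ≡⟨ m<n⇒m%n≡m (toℕ<n j) ⟨
    toℕ j % n        ≡⟨ [m+n]%n≡m%n (toℕ j) n ⟨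
    (toℕ j + n) % n  ≡⟨ cong (_% n) eq ⟨
    (toℕ i + m) % n  ∎

  stepMod-backward : ∀ {m} (i j : Fin n) → m ≤ n → StepMod n j m i → toℕ j ≡ (toℕ i + (n ∸ m)) % n
  stepMod-backward {m} i j m≤n (inj₁ eq) = begin
    toℕ j                        ≡⟨ m<n⇒m%n≡m (toℕ<n j) ⟨
    toℕ j % n                    ≡⟨ [m+n]%n≡m%n (toℕ j) n ⟨
    (toℕ j + n) % n              ≡⟨ cong (λ x → (toℕ j + x) % n) (m+[n∸m]≡n m≤n) ⟨
    (toℕ j + (m + (n ∸ m))) % n  ≡⟨ cong (_% n) (+-assoc (toℕ j) m (n ∸ m)) ⟨
    (toℕ j + m + (n ∸ m)) % n    ≡⟨ cong (λ x → (x + (n ∸ m)) % n) eq ⟩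
    (toℕ i + (n ∸ m)) % n        ∎
  stepMod-backward {m} i j m≤n (inj₂ eq) = begin
    toℕ j                  ≡⟨ m<n⇒m%n≡m (toℕ<n j) ⟨
    toℕ j % n              ≡⟨ cong (_% n) (m+n∸n≡m (toℕ j) m) ⟨
    (toℕ j + m ∸ m) % n    ≡⟨ cong (λ x → (x ∸ m) % n) eq ⟩
    (toℕ i + n ∸ m) % n    ≡⟨ cong (_% n) (+-∸-assoc (toℕ i) m≤n) ⟩
    (toℕ i + (n ∸ m)) % n  ∎

module _ {q d : ℕ} .{{_ : NonZero q}} .{{_ : NonZero d}} where
  open ≡-Reasoning

  private instance
    qd≢0 : NonZero (q * d)
    qd≢0 = m*n≢0 q d

  [r+t*d]/d≡t : ∀ {r} t → r < d → (r + t * d) / d ≡ t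
  [r+t*d]/d≡t {r} t r<d = begin
    (r + t * d) / d    ≡⟨ +-distrib-/ r (t * d) no-carry ⟩
    r / d + t * d / d  ≡⟨ cong₂ _+_ (m<n⇒m/n≡0 r<d) (m*n/n≡m t d) ⟩
    t                  ∎
    where
    no-carry : r % d + t * d % d < d
    no-carry = subst (_< d)
      (sym (trans (cong₂ _+_ (m<n⇒m%n≡m r<d) (m*n%n≡0 t d)) (+-identityʳ r))) r<d

  digits-of-[r+t*d]%[q*d] : ∀ {m r t} → r < d → m ≡ (r + t * d) % (q * d) →
                            m % d ≡ r × m / d ≡ t % q
  digits-of-[r+t*d]%[q*d] {r = r} {t} r<d refl = remainder , quotient
    where
    remainder : (r + t * d) % (q * d) % d ≡ r
    remainder = begin
      (r + t * d) % (q * d) % d  ≡⟨ m∣n⇒o%n%m≡o%m d (q * d) (r + t * d) (divides q refl) ⟩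
      (r + t * d) % d            ≡⟨ [m+kn]%n≡m%n r t d ⟩
      r % d                      ≡⟨ m<n⇒m%n≡m r<d ⟩
      r                          ∎
    quotient : (r + t * d) % (q * d) / d ≡ t % q
    quotient = begin
      (r + t * d) % (q * d) / d  ≡⟨ m%[n*o]/o≡m/o%n (r + t * d) q d ⟩
      (r + t * d) / d % q        ≡⟨ cong (_% q) ([r+t*d]/d≡t t r<d) ⟩
      t % q                      ∎

+-shift-blocks : ∀ r J m d → r + J * d + m * d ≡ r + (J + m) * d
+-shift-blocks = solve-∀

step-in-block : ∀ r J d → r + J * d + 1 ≡ suc r + J * d
step-in-block = solve-∀

step-to-next-block : ∀ r J d → suc r ≡ d → r + J * d + 1 ≡ 0 + (J + 1) * d
step-to-next-block r J _ refl = closed r J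
  where
  closed : ∀ r J → r + J * suc r + 1 ≡ 0 + (J + 1) * suc r
  closed = solve-∀

-- With q = suc q′ and d = suc d′, q * d ∸ 1 reduces to d′ + q′ * suc d′, a form without ∸ that
-- the ring solver accepts.
back-in-block : ∀ r J q d .{{_ : NonZero q}} .{{_ : NonZero d}} →
                suc r + J * d + (q * d ∸ 1) ≡ r + (J + q) * d
back-in-block r J (suc q) (suc d) = closed r J q d
  where
  closed : ∀ r J q d → suc r + J * suc d + (d + q * suc d) ≡ r + (J + suc q) * suc d
  closed = solve-∀

back-to-previous-block : ∀ J q d .{{_ : NonZero q}} .{{_ : NonZero d}} →
                         0 + J * d + (q * d ∸ 1) ≡ pred d + (J + pred q) * d
back-to-previous-block J (suc q) (suc d) = closed J q d
  where
  closed : ∀ J q d → J * suc d + (d + q * suc d) ≡ d + (J + q) * suc d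
  closed = solve-∀

-- The quotient graph

data Dir : Set where
  next prev spoke : Dir

_≟ᵈ_ : DecidableEquality Dir
next  ≟ᵈ next  = yes refl
prev  ≟ᵈ prev  = yes refl
spoke ≟ᵈ spoke = yes refl
next  ≟ᵈ prev  = no λ ()
next  ≟ᵈ spoke = no λ ()
prev  ≟ᵈ next  = no λ ()
prev  ≟ᵈ spoke = no λ ()
spoke ≟ᵈ next  = no λ ()
spoke ≟ᵈ prev  = no λ ()

∀-Dir? : {P : Dir → Set} → (∀ t → Dec (P t)) → Dec (∀ t → P t)
∀-Dir? P? = map′ (λ { (p , q , r) next → p ; (p , q , r) prev → q ; (p , q , r) spoke → r })
                 (λ f → f next , f prev , f spoke)
                 (P? next ×-dec P? prev ×-dec P? spoke)

∀-Bool? : {P : Bool → Set} → (∀ b → Dec (P b)) → Dec (∀ b → P b)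
∀-Bool? P? = map′ (λ { (p , q) false → p ; (p , q) true → q }) (λ f → f false , f true)
                  (P? false ×-dec P? true)

Reversed : Dir → Dir → Set
Reversed t t' = t ≡ next × t' ≡ prev ⊎ t ≡ prev × t' ≡ next

reversed? : ∀ t t' → Dec (Reversed t t')
reversed? t t' = (t ≟ᵈ next ×-dec t' ≟ᵈ prev) ⊎-dec (t ≟ᵈ prev ×-dec t' ≟ᵈ next)

-- Position r of a block of d = 3 a + L rim vertices carries the r-th symbol of
-- (0 1 2)^a 0 3 4 … (L + 1).  The flag first is set on the first group of three (or on the tail
-- if a = 0), whose position 0 has its rim predecessor in the previous block.
data Position : Set where
  blockStart tailStart : (first : Bool) → Position
  blockMid blockEnd : Position
  tailNext : ℕ → Position

tailSymbol : ℕ → ℕ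
tailSymbol zero    = 0
tailSymbol (suc t) = 3 + t

symbol : Position → ℕ
symbol (blockStart _) = 0
symbol blockMid       = 1
symbol blockEnd       = 2
symbol (tailStart _)  = tailSymbol 0
symbol (tailNext t)   = tailSymbol (suc t)

position : (first : Bool) (a r : ℕ) → Position
position first zero    zero                = tailStart first
position _     zero    (suc t)             = tailNext t
position first (suc a) 0                   = blockStart first
position _     (suc a) 1                   = blockMid
position _     (suc a) 2                   = blockEnd
position _     (suc a) (suc (suc (suc r))) = position false a r

-- (b , P , J) is the image of u_i (b = false) or v_i (b = true) for i at a position with symbol P
-- in block J.
Node : Set
Node = Bool × ℕ × ℕ

u v : ℕ → ℕ → Node
u P J = false , P , J
v P J = true  , P , J

_≟ₙ_ : DecidableEquality Node
_≟ₙ_ = ≡-dec Bool._≟_ (≡-dec _≟_ _≟_)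

data View : Set where
  outer : Position → ℕ → View
  inner : ℕ → ℕ → View

centre : View → Node
centre (outer p J) = u (symbol p) J
centre (inner P J) = v P J

views : Node → List View
views (false , 0 , J) =
  map (λ p → outer p J) (blockStart true ∷ blockStart false ∷ tailStart true ∷ tailStart false ∷ [])
views (false , 1 , J)                 = outer blockMid J ∷ []
views (false , 2 , J)                 = outer blockEnd J ∷ []
views (false , suc (suc (suc t)) , J) = outer (tailNext t) J ∷ []
views (true  , P , J)                 = inner P J ∷ []

∈-views-centre : ∀ e → e ∈ views (centre e)
∈-views-centre (outer (blockStart true)  J) = here refl
∈-views-centre (outer (blockStart false) J) = there (here refl)
∈-views-centre (outer (tailStart true)   J) = there (there (here refl))
∈-views-centre (outer (tailStart false)  J) = there (there (there (here refl)))
∈-views-centre (outer blockMid           J) = here refl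
∈-views-centre (outer blockEnd           J) = here refl
∈-views-centre (outer (tailNext t)       J) = here refl
∈-views-centre (inner P J)                  = here refl

module Quotient (q s l : ℕ) .{{_ : NonZero q}} where

  L : ℕ
  L = suc l

  _+ᵐ_ : ℕ → ℕ → ℕ
  J +ᵐ m = (J + m) % q

  beforeStart : (first : Bool) → ℕ → Node
  beforeStart true  J = u (tailSymbol l) (J +ᵐ pred q)
  beforeStart false J = u 2 J

  afterTail : ℕ → ℕ → Node
  afterTail t J with suc t ≟ L
  ... | yes _ = u 0 (J +ᵐ 1)
  ... | no  _ = u (tailSymbol (suc t)) J

  forward backward : Position → ℕ → Node
  forward (blockStart _) J = u 1 J
  forward blockMid       J = u 2 J
  forward blockEnd       J = u 0 J
  forward (tailStart _)  J = afterTail 0 J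
  forward (tailNext t)   J = afterTail (suc t) J

  backward (blockStart first) J = beforeStart first J
  backward (tailStart first)  J = beforeStart first J
  backward blockMid           J = u 0 J
  backward blockEnd           J = u 1 J
  backward (tailNext t)       J = u (tailSymbol t) J

  step : View → Dir → Node
  step (outer p J) next  = forward p J
  step (outer p J) prev  = backward p J
  step (outer p J) spoke = v (symbol p) J
  step (inner P J) next  = v P (J +ᵐ s)
  step (inner P J) prev  = v P (J +ᵐ (q ∸ s))
  step (inner P J) spoke = u P J

  -- The next and prev neighbours of a vertex of GP(q d, s d) coincide for inner vertices when
  -- q = 2 s, and for rim vertices when n = 2, i.e. q = 2 and d = 1, where the only rim view is
  -- outer (tailStart true) _ with L = 1.
  NextIsPrev : View → Set
  NextIsPrev (inner _ _)                = q ≡ 2 * s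
  NextIsPrev (outer (tailStart true) _) = q ≡ 2 × l ≡ 0
  NextIsPrev _                          = ⊥

  nextIsPrev? : ∀ e → Dec (NextIsPrev e)
  nextIsPrev? (inner _ _)                 = q ≟ 2 * s
  nextIsPrev? (outer (tailStart true) _)  = q ≟ 2 ×-dec l ≟ 0
  nextIsPrev? (outer (tailStart false) _) = no λ ()
  nextIsPrev? (outer (blockStart _) _)    = no λ ()
  nextIsPrev? (outer blockMid _)          = no λ ()
  nextIsPrev? (outer blockEnd _)          = no λ ()
  nextIsPrev? (outer (tailNext _) _)      = no λ ()

  Coincide : View → Dir → Dir → Set
  Coincide e t t' = t ≡ t' ⊎ (Reversed t t' × NextIsPrev e)

  coincide? : ∀ e t t' → Dec (Coincide e t t')
  coincide? e t t' = t ≟ᵈ t' ⊎-dec (reversed? t t' ×-dec nextIsPrev? e)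

  symbol-start : ∀ f a → symbol (position f a 0) ≡ 0
  symbol-start f zero    = refl
  symbol-start f (suc a) = refl

  symbol-bound : ∀ f a r → r < a * 3 + L → symbol (position f a r) < 2 + L
  symbol-bound f zero    zero    _  = s≤s z≤n
  symbol-bound f zero    (suc r) lt = s≤s (s≤s lt)
  symbol-bound f (suc a) 0       _  = s≤s z≤n
  symbol-bound f (suc a) 1       _  = s≤s (s≤s z≤n)
  symbol-bound f (suc a) 2       _  = s≤s (s≤s (s≤s z≤n))
  symbol-bound f (suc a) (suc (suc (suc r))) (s≤s (s≤s (s≤s lt))) = symbol-bound false a r lt

  symbol-last : ∀ f a r → suc r ≡ a * 3 + L → symbol (position f a r) ≡ tailSymbol l
  symbol-last f zero    zero    eq = cong tailSymbol (suc-injective eq)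
  symbol-last f zero    (suc r) eq = cong tailSymbol (suc-injective eq)
  symbol-last f (suc a) 0       ()
  symbol-last f (suc a) 1       ()
  symbol-last f (suc a) 2       eq = ⊥-elim (m+1+n≢0 (a * 3) (sym (cong (_∸ 3) eq)))
  symbol-last f (suc a) (suc (suc (suc r))) eq = symbol-last false a r (cong (_∸ 3) eq)

  afterTail-inside : ∀ {t} J → suc t < L → afterTail t J ≡ u (tailSymbol (suc t)) J
  afterTail-inside {t} J lt with suc t ≟ L
  ... | yes eq = ⊥-elim (<-irrefl eq lt)
  ... | no  _  = refl

  afterTail-last : ∀ {t} J → suc t ≡ L → afterTail t J ≡ u 0 (J +ᵐ 1)
  afterTail-last {t} J eq with suc t ≟ L
  ... | yes _  = refl
  ... | no  ne = ⊥-elim (ne eq)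

  forward-position : ∀ f a r J → suc r < a * 3 + L →
                     forward (position f a r) J ≡ u (symbol (position f a (suc r))) J
  forward-position f zero    zero    J lt = afterTail-inside J lt
  forward-position f zero    (suc r) J lt = afterTail-inside J lt
  forward-position f (suc a) 0       J _  = refl
  forward-position f (suc a) 1       J _  = refl
  forward-position f (suc a) 2       J _  = cong (λ P → u P J) (sym (symbol-start false a))
  forward-position f (suc a) (suc (suc (suc r))) J (s≤s (s≤s (s≤s lt))) =
    forward-position false a r J lt

  forward-last : ∀ f a r J → suc r ≡ a * 3 + L → forward (position f a r) J ≡ u 0 (J +ᵐ 1)
  forward-last f zero    zero    J eq = afterTail-last J eq
  forward-last f zero    (suc r) J eq = afterTail-last J eq
  forward-last f (suc a) 0       J ()
  forward-last f (suc a) 1       J ()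
  forward-last f (suc a) 2       J eq = ⊥-elim (m+1+n≢0 (a * 3) (sym (cong (_∸ 3) eq)))
  forward-last f (suc a) (suc (suc (suc r))) J eq = forward-last false a r J (cong (_∸ 3) eq)

  backward-start : ∀ f a J → backward (position f a 0) J ≡ beforeStart f J
  backward-start f zero    J = refl
  backward-start f (suc a) J = refl

  backward-position : ∀ f a r J → suc r < a * 3 + L →
                      backward (position f a (suc r)) J ≡ u (symbol (position f a r)) J
  backward-position f zero    zero    J _ = refl
  backward-position f zero    (suc r) J _ = refl
  backward-position f (suc a) 0       J _ = refl
  backward-position f (suc a) 1       J _ = refl
  backward-position f (suc a) 2       J _ = backward-start false a J
  backward-position f (suc a) (suc (suc (suc r))) J (s≤s (s≤s (s≤s lt))) =
    backward-position false a r J lt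

  nextIsPrev-position : ∀ f a r {J} → NextIsPrev (outer (position f a r) J) →
                        f ≡ true × a ≡ 0 × q ≡ 2 × l ≡ 0
  nextIsPrev-position true  zero    zero    q≡2,l≡0 = refl , refl , q≡2,l≡0
  nextIsPrev-position false zero    zero    ()
  nextIsPrev-position f     zero    (suc r) ()
  nextIsPrev-position f     (suc a) 0       ()
  nextIsPrev-position f     (suc a) 1       ()
  nextIsPrev-position f     (suc a) 2       ()
  nextIsPrev-position f     (suc a) (suc (suc (suc r))) np with nextIsPrev-position false a r np
  ... | () , _

  module _ (c : Node → Node → Fin 5) where

    SymmetricAt : View → Set
    SymmetricAt e = ∀ t → c (centre e) (step e t) ≡ c (step e t) (centre e)

    ProperAt : View → Set
    ProperAt e = ∀ t t' → ¬ Coincide e t t' → c (centre e) (step e t) ≢ c (centre e) (step e t')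

    -- e₁, e₂, e₃ are the views of the three middle vertices of a non-backtracking walk.
    NoAlternationAt : View → Set
    NoAlternationAt e₁ = ∀ t₁ t₁' → ¬ Coincide e₁ t₁ t₁' →
      All (λ e₂ → ∀ t₂ → step e₂ t₂ ≡ centre e₁ → ∀ t₂' → ¬ Coincide e₂ t₂ t₂' →
        All (λ e₃ → ∀ t₃ → step e₃ t₃ ≡ centre e₂ → ∀ t₃' → ¬ Coincide e₃ t₃ t₃' →
               ¬ Alternates (c (step e₁ t₁) (centre e₁)) (c (centre e₁) (centre e₂))
                            (c (centre e₂) (centre e₃)) (c (centre e₃) (step e₃ t₃')))
            (views (step e₂ t₂')))
        (views (step e₁ t₁'))

    LocallyStar : View → Set
    LocallyStar e = SymmetricAt e × ProperAt e × NoAlternationAt e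

    Certificate : Set
    Certificate = ∀ b (P : Fin (2 + L)) (J : Fin q) → All LocallyStar (views (b , toℕ P , toℕ J))

    certificate? : Dec Certificate
    certificate? = ∀-Bool? λ b → all? λ P → all? λ J → All.all? locallyStar? _
      where
      _≟ᶜ_ : DecidableEquality (Fin 5)
      _≟ᶜ_ = Fin._≟_

      locallyStar? : ∀ e₁ → Dec (LocallyStar e₁)
      locallyStar? e₁ =
        (∀-Dir? λ t → c _ (step e₁ t) ≟ᶜ c (step e₁ t) _) ×-dec
        (∀-Dir? λ t → ∀-Dir? λ t' →
           ¬? (coincide? e₁ t t') →-dec ¬? (c _ (step e₁ t) ≟ᶜ c _ (step e₁ t'))) ×-dec
        (∀-Dir? λ t₁ → ∀-Dir? λ t₁' → ¬? (coincide? e₁ t₁ t₁') →-dec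
          All.all? (λ e₂ → ∀-Dir? λ t₂ → step e₂ t₂ ≟ₙ centre e₁ →-dec
                           ∀-Dir? λ t₂' → ¬? (coincide? e₂ t₂ t₂') →-dec
            All.all? (λ e₃ → ∀-Dir? λ t₃ → step e₃ t₃ ≟ₙ centre e₂ →-dec
                             ∀-Dir? λ t₃' → ¬? (coincide? e₃ t₃ t₃') →-dec
                             ¬? ((c _ _ ≟ᶜ c _ _) ×-dec (c _ _ ≟ᶜ c _ _)))
              _)
            _)

-- Pulling a certified coloring back to GP(q d, s d)

module Pullback (q s l a : ℕ) .{{_ : NonZero q}} (s≤q : s ≤ q)
                (c : Node → Node → Fin 5) (certificate : Quotient.Certificate q s l c) where

  open Quotient q s l
  open ≡-Reasoning

  d n k : ℕ
  d = a * 3 + L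
  n = q * d
  k = s * d

  instance
    d≢0 : NonZero d
    d≢0 = >-nonZero (≤-trans (s≤s z≤n) (m≤n+m L (a * 3)))

    n≢0 : NonZero n
    n≢0 = m*n≢0 q d

  Vertex : Set
  Vertex = Bool × Fin n

  rem quo : Fin n → ℕ
  rem i = toℕ i % d
  quo i = toℕ i / d

  rem<d : ∀ i → rem i < d
  rem<d i = m%n<n (toℕ i) d

  quo<q : ∀ i → quo i < q
  quo<q i = m<n*o⇒m/o<n (toℕ<n i)

  quo%q : ∀ i → quo i % q ≡ quo i
  quo%q i = m<n⇒m%n≡m (quo<q i)

  index : ∀ i → toℕ i ≡ rem i + quo i * d
  index i = m≡m%n+[m/n]*n (toℕ i) d

  view : Vertex → View
  view (false , i) = outer (position true a (rem i)) (quo i)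
  view (true  , i) = inner (symbol (position true a (rem i))) (quo i)

  φ : Vertex → Node
  φ x = centre (view x)

  φ-components : ∀ b i → φ (b , i) ≡ (b , symbol (position true a (rem i)) , quo i)
  φ-components false i = refl
  φ-components true  i = refl

  offset : Bool → Dir → ℕ
  offset _     spoke = 0
  offset false next  = 1
  offset false prev  = n ∸ 1
  offset true  next  = k
  offset true  prev  = n ∸ k

  sideAfter : Bool → Dir → Bool
  sideAfter b spoke = not b
  sideAfter b _     = b

  _─[_]→_ : Vertex → Dir → Vertex → Set
  (b , i) ─[ t ]→ (b' , j) = b' ≡ sideAfter b t × toℕ j ≡ (toℕ i + offset b t) % n

  classify : ∀ x y → GPAdj n k x y → ∃[ t ] x ─[ t ]→ y
  classify (false , i) (false , j) (inj₁ st) = next  , refl , stepMod-forward i j st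
  classify (false , i) (false , j) (inj₂ st) = prev  , refl , stepMod-backward i j (>-nonZero⁻¹ n) st
  classify (true  , i) (true  , j) (inj₁ st) = next  , refl , stepMod-forward i j st
  classify (true  , i) (true  , j) (inj₂ st) = prev  , refl , stepMod-backward i j (*-monoˡ-≤ d s≤q) st
  classify (false , i) (true  , j) refl      = spoke , refl , stepMod-forward i i (inj₁ (+-identityʳ _))
  classify (true  , i) (false , j) refl      = spoke , refl , stepMod-forward i i (inj₁ (+-identityʳ _))

  same-target : ∀ {b i t t' y z} → offset b t ≡ offset b t' → sideAfter b t ≡ sideAfter b t' →
                (b , i) ─[ t ]→ y → (b , i) ─[ t' ]→ z → y ≡ z
  same-target {i = i} {y = _ , _} {z = _ , _} eo es (refl , ey) (refl , ez) =
    cong₂ _,_ es (toℕ-injective (trans ey (trans (cong (λ o → (toℕ i + o) % n) eo) (sym ez))))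

  inner-antipodal : q ≡ 2 * s → k ≡ n ∸ k
  inner-antipodal q≡2s = begin
    s * d            ≡⟨ cong (_* d) (m+n∸m≡n s s) ⟨
    (s + s ∸ s) * d  ≡⟨ cong (λ x → (x ∸ s) * d) (trans (cong (s +_) (sym (+-identityʳ s))) (sym q≡2s)) ⟩
    (q ∸ s) * d      ≡⟨ *-distribʳ-∸ d q s ⟩
    q * d ∸ s * d    ∎

  rim-antipodal : a ≡ 0 → q ≡ 2 → l ≡ 0 → 1 ≡ n ∸ 1
  rim-antipodal a≡0 q≡2 l≡0 =
    sym (cong (_∸ 1) (cong₂ _*_ q≡2 (cong₂ (λ a l → a * 3 + suc l) a≡0 l≡0)))

  coincide⇒≡ : ∀ x t t' {y z} → x ─[ t ]→ y → x ─[ t' ]→ z → Coincide (view x) t t' → y ≡ z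
  coincide⇒≡ (b , i) t t' x→y x→z (inj₁ refl) = same-target {b} {i} {t} {t} refl refl x→y x→z
  coincide⇒≡ (true , i) .next .prev x→y x→z (inj₂ (inj₁ (refl , refl) , q≡2s)) =
    same-target {true} {i} {next} {prev} (inner-antipodal q≡2s) refl x→y x→z
  coincide⇒≡ (true , i) .prev .next x→y x→z (inj₂ (inj₂ (refl , refl) , q≡2s)) =
    same-target {true} {i} {prev} {next} (sym (inner-antipodal q≡2s)) refl x→y x→z
  coincide⇒≡ (false , i) .next .prev x→y x→z (inj₂ (inj₁ (refl , refl) , np)) =
    let _ , a≡0 , q≡2 , l≡0 = nextIsPrev-position true a (rem i) np in
    same-target {false} {i} {next} {prev} (rim-antipodal a≡0 q≡2 l≡0) refl x→y x→z
  coincide⇒≡ (false , i) .prev .next x→y x→z (inj₂ (inj₂ (refl , refl) , np)) =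
    let _ , a≡0 , q≡2 , l≡0 = nextIsPrev-position true a (rem i) np in
    same-target {false} {i} {prev} {next} (sym (rim-antipodal a≡0 q≡2 l≡0)) refl x→y x→z

  distinct : ∀ x t t' {y z} → x ─[ t ]→ y → x ─[ t' ]→ z → y ≢ z → ¬ Coincide (view x) t t'
  distinct x t t' x→y x→z y≢z = y≢z ∘′ coincide⇒≡ x t t' x→y x→z

  φ-shift : ∀ b (i j : Fin n) o r t → r < d → toℕ j ≡ (toℕ i + o) % n → toℕ i + o ≡ r + t * d →
            φ (b , j) ≡ (b , symbol (position true a r) , t % q)
  φ-shift b i j o r t r<d eq split
    with digits-of-[r+t*d]%[q*d] {q} {d} r<d (trans eq (cong (_% n) split))
  ... | rem≡r , quo≡t =
    trans (φ-components b j) (cong₂ (λ r J → b , symbol (position true a r) , J) rem≡r quo≡t)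

  φ-forward : ∀ i j → toℕ j ≡ (toℕ i + 1) % n →
              φ (false , j) ≡ forward (position true a (rem i)) (quo i)
  φ-forward i j eq with m≤n⇒m<n∨m≡n (rem<d i)
  ... | inj₁ r+1<d = begin
    φ (false , j)
      ≡⟨ φ-shift false i j 1 (suc (rem i)) (quo i) r+1<d eq
           (trans (cong (_+ 1) (index i)) (step-in-block (rem i) (quo i) d)) ⟩
    u (symbol (position true a (suc (rem i)))) (quo i % q)
      ≡⟨ cong (u _) (quo%q i) ⟩
    u (symbol (position true a (suc (rem i)))) (quo i)
      ≡⟨ forward-position true a (rem i) (quo i) r+1<d ⟨
    forward (position true a (rem i)) (quo i)
      ∎
  ... | inj₂ r+1≡d = begin
    φ (false , j)
      ≡⟨ φ-shift false i j 1 0 (quo i + 1) (>-nonZero⁻¹ d) eq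
           (trans (cong (_+ 1) (index i)) (step-to-next-block (rem i) (quo i) d r+1≡d)) ⟩
    u (symbol (position true a 0)) (quo i +ᵐ 1)
      ≡⟨ cong (λ P → u P (quo i +ᵐ 1)) (symbol-start true a) ⟩
    u 0 (quo i +ᵐ 1)
      ≡⟨ forward-last true a (rem i) (quo i) r+1≡d ⟨
    forward (position true a (rem i)) (quo i)
      ∎

  φ-backward : ∀ i j → toℕ j ≡ (toℕ i + (n ∸ 1)) % n →
               φ (false , j) ≡ backward (position true a (rem i)) (quo i)
  φ-backward i j eq with rem i | rem<d i | index i
  ... | zero | _ | split = begin
    φ (false , j)
      ≡⟨ φ-shift false i j (n ∸ 1) (pred d) (quo i + pred q) (≤-reflexive (suc-pred d)) eq
           (trans (cong (_+ (n ∸ 1)) split) (back-to-previous-block (quo i) q d)) ⟩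
    u (symbol (position true a (pred d))) (quo i +ᵐ pred q)
      ≡⟨ cong (λ P → u P (quo i +ᵐ pred q)) (symbol-last true a (pred d) (suc-pred d)) ⟩
    beforeStart true (quo i)
      ≡⟨ backward-start true a (quo i) ⟨
    backward (position true a 0) (quo i)
      ∎
  ... | suc r | r+1<d | split = begin
    φ (false , j)
      ≡⟨ φ-shift false i j (n ∸ 1) r (quo i + q) (<-trans (n<1+n r) r+1<d) eq
           (trans (cong (_+ (n ∸ 1)) split) (back-in-block r (quo i) q d)) ⟩
    u (symbol (position true a r)) ((quo i + q) % q)
      ≡⟨ cong (u _) (trans ([m+n]%n≡m%n (quo i) q) (quo%q i)) ⟩
    u (symbol (position true a r)) (quo i)
      ≡⟨ backward-position true a r (quo i) r+1<d ⟨
    backward (position true a (suc r)) (quo i)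
      ∎

  φ-step : ∀ x t {y} → x ─[ t ]→ y → φ y ≡ step (view x) t
  φ-step (false , i) next  {_ , j} (refl , eq) = φ-forward i j eq
  φ-step (false , i) prev  {_ , j} (refl , eq) = φ-backward i j eq
  φ-step (true  , i) next  {_ , j} (refl , eq) =
    φ-shift true i j k (rem i) (quo i + s) (rem<d i) eq
      (trans (cong (_+ k) (index i)) (+-shift-blocks (rem i) (quo i) s d))
  φ-step (true  , i) prev  {_ , j} (refl , eq) =
    φ-shift true i j (n ∸ k) (rem i) (quo i + (q ∸ s)) (rem<d i) eq
      (trans (cong₂ _+_ (index i) (sym (*-distribʳ-∸ d q s)))
             (+-shift-blocks (rem i) (quo i) (q ∸ s) d))
  φ-step (b     , i) spoke {_ , j} (refl , eq) = begin
    φ (not b , j)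
      ≡⟨ φ-shift (not b) i j 0 (rem i) (quo i) (rem<d i) eq (trans (+-identityʳ (toℕ i)) (index i)) ⟩
    (not b , symbol (position true a (rem i)) , quo i % q)
      ≡⟨ cong (λ J → not b , symbol (position true a (rem i)) , J) (quo%q i) ⟩
    (not b , symbol (position true a (rem i)) , quo i)
      ≡⟨ spoke-end b ⟩
    step (view (b , i)) spoke
      ∎
    where
    spoke-end : ∀ b → (not b , symbol (position true a (rem i)) , quo i) ≡ step (view (b , i)) spoke
    spoke-end false = refl
    spoke-end true  = refl

  view-∈ : ∀ x t {y} → x ─[ t ]→ y → view y ∈ views (step (view x) t)
  view-∈ x t {y} x→y = subst (λ w → view y ∈ views w) (φ-step x t x→y) (∈-views-centre (view y))

  locally-star : ∀ x → LocallyStar c (view x)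
  locally-star (b , i) = All.lookup certified (∈-views-centre (view (b , i)))
    where
    P<2+L = symbol-bound true a (rem i) (rem<d i)
    certified : All (LocallyStar c) (views (φ (b , i)))
    certified = subst (λ y → All (LocallyStar c) (views y))
      (trans (cong₂ (λ P J → b , P , J) (toℕ-fromℕ< P<2+L) (toℕ-fromℕ< (quo<q i)))
             (sym (φ-components b i)))
      (certificate b (fromℕ< P<2+L) (fromℕ< (quo<q i)))

  color : Vertex → Vertex → Fin 5
  color x y = c (φ x) (φ y)

  symmetric : Symmetric (GP n k) color
  symmetric x y adj with classify x y adj
  ... | t , x→y = subst (λ w → c (φ x) w ≡ c w (φ x)) (sym (φ-step x t x→y)) (proj₁ (locally-star x) t)

  proper : Proper (GP n k) color
  proper x y z adj adj' y≢z with classify x y adj | classify x z adj'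
  ... | t , x→y | t' , x→z =
    subst₂ (λ w w' → c (φ x) w ≢ c (φ x) w') (sym (φ-step x t x→y)) (sym (φ-step x t' x→z))
      (proj₁ (proj₂ (locally-star x)) t t' (distinct x t t' x→y x→z y≢z))

  no-alternation : NoAlternatingWalk (GP n k) color
  no-alternation x₀ x₁ x₂ x₃ x₄ (a₀₁ , a₁₂ , a₂₃ , a₃₄ , x₀≢x₂ , x₁≢x₃ , x₂≢x₄)
    with classify x₁ x₀ (GPAdj-sym x₀ x₁ a₀₁) | classify x₁ x₂ a₁₂
       | classify x₂ x₁ (GPAdj-sym x₁ x₂ a₁₂) | classify x₂ x₃ a₂₃
       | classify x₃ x₂ (GPAdj-sym x₂ x₃ a₂₃) | classify x₃ x₄ a₃₄
  ... | t₁ , x₁→x₀ | t₁' , x₁→x₂ | t₂ , x₂→x₁ | t₂' , x₂→x₃ | t₃ , x₃→x₂ | t₃' , x₃→x₄ =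
    subst₂ (λ y₀ y₄ → ¬ Alternates (c y₀ (φ x₁)) (c (φ x₁) (φ x₂)) (c (φ x₂) (φ x₃)) (c (φ x₃) y₄))
      (sym (φ-step x₁ t₁ x₁→x₀)) (sym (φ-step x₃ t₃' x₃→x₄))
      (All.lookup
        (All.lookup (proj₂ (proj₂ (locally-star x₁)) t₁ t₁' (distinct x₁ t₁ t₁' x₁→x₀ x₁→x₂ x₀≢x₂))
                    (view-∈ x₁ t₁' x₁→x₂)
                    t₂ (sym (φ-step x₂ t₂ x₂→x₁)) t₂' (distinct x₂ t₂ t₂' x₂→x₁ x₂→x₃ x₁≢x₃))
        (view-∈ x₂ t₂' x₂→x₃)
        t₃ (sym (φ-step x₃ t₃ x₃→x₂)) t₃' (distinct x₃ t₃ t₃' x₃→x₂ x₃→x₄ x₂≢x₄))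

  star-colorable : StarEdgeColorable (GP n k) 5
  star-colorable =
    color , star-if-no-alternating-walk (GP n k) color GPAdj-sym symmetric proper no-alternation

-- The nine certified colorings

infix 6 _─_↦_

data Edge : Set where
  _─_↦_ : Node → Node → Fin 5 → Edge

-- table P J lists edges with an end at u P J or v P J; an edge may be filed under either end.
Table : Set
Table = ℕ → ℕ → List Edge

-- Used only for color lookup; no correctness property is needed, as the certificate is checked
-- on the resulting coloring.
_==_ : Node → Node → Bool
(b , P , J) == (b' , P' , J') = not (b Bool.xor b') ∧ (P ≡ᵇ P') ∧ (J ≡ᵇ J')

colorIn : List Edge → Node → Node → Fin 5
colorIn []                    y z = Fin.zero
colorIn ((a ─ b ↦ col) ∷ es) y z =
  if (a == y ∧ b == z) ∨ (a == z ∧ b == y) then col else colorIn es y z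

coloring : Table → Node → Node → Fin 5
coloring table y@(_ , P , J) z@(_ , P' , J') = colorIn (table P J ++ table P' J') y z

table[2,1,1] : Table
table[2,1,1] 0 0 = u 0 0 ─ v 0 0 ↦ # 4 ∷ u 0 0 ─ u 0 1 ↦ # 2 ∷ u 0 0 ─ u 1 0 ↦ # 3 ∷ u 0 0 ─ u 2 0 ↦ # 0 ∷
                   v 0 0 ─ v 0 1 ↦ # 1 ∷ []
table[2,1,1] 0 1 = u 0 1 ─ v 0 1 ↦ # 0 ∷ u 0 1 ─ u 1 1 ↦ # 3 ∷ u 0 1 ─ u 2 1 ↦ # 1 ∷ []
table[2,1,1] 1 0 = u 1 0 ─ v 1 0 ↦ # 1 ∷ u 1 0 ─ u 2 0 ↦ # 4 ∷ v 1 0 ─ v 1 1 ↦ # 2 ∷ []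
table[2,1,1] 1 1 = u 1 1 ─ v 1 1 ↦ # 0 ∷ u 1 1 ─ u 2 1 ↦ # 4 ∷ []
table[2,1,1] 2 0 = u 2 0 ─ v 2 0 ↦ # 1 ∷ v 2 0 ─ v 2 1 ↦ # 0 ∷ []
table[2,1,1] 2 1 = u 2 1 ─ v 2 1 ↦ # 3 ∷ []
table[2,1,1] _ _ = []

table[2,1,2] : Table
table[2,1,2] 0 0 = u 0 0 ─ v 0 0 ↦ # 4 ∷ u 0 0 ─ u 1 0 ↦ # 1 ∷ u 0 0 ─ u 2 0 ↦ # 3 ∷ u 0 0 ─ u 3 0 ↦ # 1 ∷
                   u 0 0 ─ u 3 1 ↦ # 3 ∷ v 0 0 ─ v 0 1 ↦ # 2 ∷ []
table[2,1,2] 0 1 = u 0 1 ─ v 0 1 ↦ # 0 ∷ u 0 1 ─ u 1 1 ↦ # 2 ∷ u 0 1 ─ u 2 1 ↦ # 3 ∷ u 0 1 ─ u 3 0 ↦ # 3 ∷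
                   u 0 1 ─ u 3 1 ↦ # 2 ∷ []
table[2,1,2] 1 0 = u 1 0 ─ v 1 0 ↦ # 2 ∷ u 1 0 ─ u 2 0 ↦ # 0 ∷ v 1 0 ─ v 1 1 ↦ # 0 ∷ []
table[2,1,2] 1 1 = u 1 1 ─ v 1 1 ↦ # 3 ∷ u 1 1 ─ u 2 1 ↦ # 1 ∷ []
table[2,1,2] 2 0 = u 2 0 ─ v 2 0 ↦ # 4 ∷ v 2 0 ─ v 2 1 ↦ # 2 ∷ []
table[2,1,2] 2 1 = u 2 1 ─ v 2 1 ↦ # 4 ∷ []
table[2,1,2] 3 0 = u 3 0 ─ v 3 0 ↦ # 0 ∷ v 3 0 ─ v 3 1 ↦ # 2 ∷ []
table[2,1,2] 3 1 = u 3 1 ─ v 3 1 ↦ # 4 ∷ []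
table[2,1,2] _ _ = []

table[2,1,3] : Table
table[2,1,3] 0 0 = u 0 0 ─ v 0 0 ↦ # 2 ∷ u 0 0 ─ u 1 0 ↦ # 3 ∷ u 0 0 ─ u 2 0 ↦ # 0 ∷ u 0 0 ─ u 3 0 ↦ # 4 ∷
                   u 0 0 ─ u 4 1 ↦ # 0 ∷ v 0 0 ─ v 0 1 ↦ # 3 ∷ []
table[2,1,3] 0 1 = u 0 1 ─ v 0 1 ↦ # 0 ∷ u 0 1 ─ u 1 1 ↦ # 3 ∷ u 0 1 ─ u 2 1 ↦ # 4 ∷ u 0 1 ─ u 3 1 ↦ # 2 ∷
                   u 0 1 ─ u 4 0 ↦ # 4 ∷ []
table[2,1,3] 1 0 = u 1 0 ─ v 1 0 ↦ # 1 ∷ u 1 0 ─ u 2 0 ↦ # 4 ∷ v 1 0 ─ v 1 1 ↦ # 0 ∷ []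
table[2,1,3] 1 1 = u 1 1 ─ v 1 1 ↦ # 2 ∷ u 1 1 ─ u 2 1 ↦ # 1 ∷ []
table[2,1,3] 2 0 = u 2 0 ─ v 2 0 ↦ # 1 ∷ v 2 0 ─ v 2 1 ↦ # 3 ∷ []
table[2,1,3] 2 1 = u 2 1 ─ v 2 1 ↦ # 0 ∷ []
table[2,1,3] 3 0 = u 3 0 ─ v 3 0 ↦ # 2 ∷ u 3 0 ─ u 4 0 ↦ # 1 ∷ v 3 0 ─ v 3 1 ↦ # 1 ∷ []
table[2,1,3] 3 1 = u 3 1 ─ v 3 1 ↦ # 3 ∷ u 3 1 ─ u 4 1 ↦ # 4 ∷ []
table[2,1,3] 4 0 = u 4 0 ─ v 4 0 ↦ # 3 ∷ v 4 0 ─ v 4 1 ↦ # 0 ∷ []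
table[2,1,3] 4 1 = u 4 1 ─ v 4 1 ↦ # 1 ∷ []
table[2,1,3] _ _ = []

table[5,1,1] : Table
table[5,1,1] 0 0 = u 0 0 ─ v 0 0 ↦ # 0 ∷ u 0 0 ─ u 0 1 ↦ # 3 ∷ u 0 0 ─ u 0 4 ↦ # 4 ∷ u 0 0 ─ u 1 0 ↦ # 3 ∷
                   u 0 0 ─ u 2 0 ↦ # 4 ∷ v 0 0 ─ v 0 1 ↦ # 1 ∷ v 0 0 ─ v 0 4 ↦ # 2 ∷ []
table[5,1,1] 0 1 = u 0 1 ─ v 0 1 ↦ # 0 ∷ u 0 1 ─ u 0 2 ↦ # 2 ∷ u 0 1 ─ u 1 1 ↦ # 2 ∷ u 0 1 ─ u 2 1 ↦ # 3 ∷
                   v 0 1 ─ v 0 2 ↦ # 2 ∷ []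
table[5,1,1] 0 2 = u 0 2 ─ v 0 2 ↦ # 4 ∷ u 0 2 ─ u 0 3 ↦ # 1 ∷ u 0 2 ─ u 1 2 ↦ # 1 ∷ u 0 2 ─ u 2 2 ↦ # 2 ∷
                   v 0 2 ─ v 0 3 ↦ # 3 ∷ []
table[5,1,1] 0 3 = u 0 3 ─ v 0 3 ↦ # 4 ∷ u 0 3 ─ u 0 4 ↦ # 2 ∷ u 0 3 ─ u 1 3 ↦ # 2 ∷ u 0 3 ─ u 2 3 ↦ # 0 ∷
                   v 0 3 ─ v 0 4 ↦ # 0 ∷ []
table[5,1,1] 0 4 = u 0 4 ─ v 0 4 ↦ # 3 ∷ u 0 4 ─ u 1 4 ↦ # 4 ∷ u 0 4 ─ u 2 4 ↦ # 2 ∷ []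
table[5,1,1] 1 0 = u 1 0 ─ v 1 0 ↦ # 1 ∷ u 1 0 ─ u 2 0 ↦ # 0 ∷ v 1 0 ─ v 1 1 ↦ # 0 ∷ v 1 0 ─ v 1 4 ↦ # 2 ∷
                   []
table[5,1,1] 1 1 = u 1 1 ─ v 1 1 ↦ # 3 ∷ u 1 1 ─ u 2 1 ↦ # 1 ∷ v 1 1 ─ v 1 2 ↦ # 4 ∷ []
table[5,1,1] 1 2 = u 1 2 ─ v 1 2 ↦ # 0 ∷ u 1 2 ─ u 2 2 ↦ # 3 ∷ v 1 2 ─ v 1 3 ↦ # 1 ∷ []
table[5,1,1] 1 3 = u 1 3 ─ v 1 3 ↦ # 4 ∷ u 1 3 ─ u 2 3 ↦ # 3 ∷ v 1 3 ─ v 1 4 ↦ # 3 ∷ []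
table[5,1,1] 1 4 = u 1 4 ─ v 1 4 ↦ # 1 ∷ u 1 4 ─ u 2 4 ↦ # 0 ∷ []
table[5,1,1] 2 0 = u 2 0 ─ v 2 0 ↦ # 2 ∷ v 2 0 ─ v 2 1 ↦ # 0 ∷ v 2 0 ─ v 2 4 ↦ # 3 ∷ []
table[5,1,1] 2 1 = u 2 1 ─ v 2 1 ↦ # 4 ∷ v 2 1 ─ v 2 2 ↦ # 1 ∷ []
table[5,1,1] 2 2 = u 2 2 ─ v 2 2 ↦ # 0 ∷ v 2 2 ─ v 2 3 ↦ # 2 ∷ []
table[5,1,1] 2 3 = u 2 3 ─ v 2 3 ↦ # 1 ∷ v 2 3 ─ v 2 4 ↦ # 4 ∷ []
table[5,1,1] 2 4 = u 2 4 ─ v 2 4 ↦ # 1 ∷ []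
table[5,1,1] _ _ = []

table[5,1,2] : Table
table[5,1,2] 0 0 = u 0 0 ─ v 0 0 ↦ # 3 ∷ u 0 0 ─ u 1 0 ↦ # 0 ∷ u 0 0 ─ u 2 0 ↦ # 4 ∷ u 0 0 ─ u 3 0 ↦ # 0 ∷
                   u 0 0 ─ u 3 4 ↦ # 1 ∷ v 0 0 ─ v 0 1 ↦ # 1 ∷ v 0 0 ─ v 0 4 ↦ # 2 ∷ []
table[5,1,2] 0 1 = u 0 1 ─ v 0 1 ↦ # 4 ∷ u 0 1 ─ u 1 1 ↦ # 0 ∷ u 0 1 ─ u 2 1 ↦ # 3 ∷ u 0 1 ─ u 3 0 ↦ # 2 ∷
                   u 0 1 ─ u 3 1 ↦ # 1 ∷ v 0 1 ─ v 0 2 ↦ # 2 ∷ []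
table[5,1,2] 0 2 = u 0 2 ─ v 0 2 ↦ # 3 ∷ u 0 2 ─ u 1 2 ↦ # 0 ∷ u 0 2 ─ u 2 2 ↦ # 2 ∷ u 0 2 ─ u 3 1 ↦ # 2 ∷
                   u 0 2 ─ u 3 2 ↦ # 0 ∷ v 0 2 ─ v 0 3 ↦ # 0 ∷ []
table[5,1,2] 0 3 = u 0 3 ─ v 0 3 ↦ # 2 ∷ u 0 3 ─ u 1 3 ↦ # 3 ∷ u 0 3 ─ u 2 3 ↦ # 1 ∷ u 0 3 ─ u 3 2 ↦ # 1 ∷
                   u 0 3 ─ u 3 3 ↦ # 3 ∷ v 0 3 ─ v 0 4 ↦ # 4 ∷ []
table[5,1,2] 0 4 = u 0 4 ─ v 0 4 ↦ # 0 ∷ u 0 4 ─ u 1 4 ↦ # 2 ∷ u 0 4 ─ u 2 4 ↦ # 1 ∷ u 0 4 ─ u 3 3 ↦ # 1 ∷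
                   u 0 4 ─ u 3 4 ↦ # 2 ∷ []
table[5,1,2] 1 0 = u 1 0 ─ v 1 0 ↦ # 1 ∷ u 1 0 ─ u 2 0 ↦ # 2 ∷ v 1 0 ─ v 1 1 ↦ # 3 ∷ v 1 0 ─ v 1 4 ↦ # 4 ∷
                   []
table[5,1,2] 1 1 = u 1 1 ─ v 1 1 ↦ # 1 ∷ u 1 1 ─ u 2 1 ↦ # 4 ∷ v 1 1 ─ v 1 2 ↦ # 0 ∷ []
table[5,1,2] 1 2 = u 1 2 ─ v 1 2 ↦ # 4 ∷ u 1 2 ─ u 2 2 ↦ # 1 ∷ v 1 2 ─ v 1 3 ↦ # 2 ∷ []
table[5,1,2] 1 3 = u 1 3 ─ v 1 3 ↦ # 1 ∷ u 1 3 ─ u 2 3 ↦ # 4 ∷ v 1 3 ─ v 1 4 ↦ # 0 ∷ []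
table[5,1,2] 1 4 = u 1 4 ─ v 1 4 ↦ # 1 ∷ u 1 4 ─ u 2 4 ↦ # 3 ∷ []
table[5,1,2] 2 0 = u 2 0 ─ v 2 0 ↦ # 3 ∷ v 2 0 ─ v 2 1 ↦ # 2 ∷ v 2 0 ─ v 2 4 ↦ # 1 ∷ []
table[5,1,2] 2 1 = u 2 1 ─ v 2 1 ↦ # 1 ∷ v 2 1 ─ v 2 2 ↦ # 0 ∷ []
table[5,1,2] 2 2 = u 2 2 ─ v 2 2 ↦ # 4 ∷ v 2 2 ─ v 2 3 ↦ # 3 ∷ []
table[5,1,2] 2 3 = u 2 3 ─ v 2 3 ↦ # 2 ∷ v 2 3 ─ v 2 4 ↦ # 0 ∷ []
table[5,1,2] 2 4 = u 2 4 ─ v 2 4 ↦ # 4 ∷ []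
table[5,1,2] 3 0 = u 3 0 ─ v 3 0 ↦ # 3 ∷ v 3 0 ─ v 3 1 ↦ # 1 ∷ v 3 0 ─ v 3 4 ↦ # 2 ∷ []
table[5,1,2] 3 1 = u 3 1 ─ v 3 1 ↦ # 0 ∷ v 3 1 ─ v 3 2 ↦ # 3 ∷ []
table[5,1,2] 3 2 = u 3 2 ─ v 3 2 ↦ # 4 ∷ v 3 2 ─ v 3 3 ↦ # 2 ∷ []
table[5,1,2] 3 3 = u 3 3 ─ v 3 3 ↦ # 4 ∷ v 3 3 ─ v 3 4 ↦ # 0 ∷ []
table[5,1,2] 3 4 = u 3 4 ─ v 3 4 ↦ # 4 ∷ []
table[5,1,2] _ _ = []

table[5,1,3] : Table
table[5,1,3] 0 0 = u 0 0 ─ v 0 0 ↦ # 3 ∷ u 0 0 ─ u 1 0 ↦ # 2 ∷ u 0 0 ─ u 2 0 ↦ # 0 ∷ u 0 0 ─ u 3 0 ↦ # 2 ∷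
                   u 0 0 ─ u 4 4 ↦ # 0 ∷ v 0 0 ─ v 0 1 ↦ # 2 ∷ v 0 0 ─ v 0 4 ↦ # 0 ∷ []
table[5,1,3] 0 1 = u 0 1 ─ v 0 1 ↦ # 1 ∷ u 0 1 ─ u 1 1 ↦ # 2 ∷ u 0 1 ─ u 2 1 ↦ # 4 ∷ u 0 1 ─ u 3 1 ↦ # 2 ∷
                   u 0 1 ─ u 4 0 ↦ # 4 ∷ v 0 1 ─ v 0 2 ↦ # 0 ∷ []
table[5,1,3] 0 2 = u 0 2 ─ v 0 2 ↦ # 4 ∷ u 0 2 ─ u 1 2 ↦ # 1 ∷ u 0 2 ─ u 2 2 ↦ # 0 ∷ u 0 2 ─ u 3 2 ↦ # 1 ∷
                   u 0 2 ─ u 4 1 ↦ # 2 ∷ v 0 2 ─ v 0 3 ↦ # 3 ∷ []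
table[5,1,3] 0 3 = u 0 3 ─ v 0 3 ↦ # 1 ∷ u 0 3 ─ u 1 3 ↦ # 3 ∷ u 0 3 ─ u 2 3 ↦ # 2 ∷ u 0 3 ─ u 3 3 ↦ # 3 ∷
                   u 0 3 ─ u 4 2 ↦ # 2 ∷ v 0 3 ─ v 0 4 ↦ # 4 ∷ []
table[5,1,3] 0 4 = u 0 4 ─ v 0 4 ↦ # 1 ∷ u 0 4 ─ u 1 4 ↦ # 0 ∷ u 0 4 ─ u 2 4 ↦ # 2 ∷ u 0 4 ─ u 3 4 ↦ # 0 ∷
                   u 0 4 ─ u 4 3 ↦ # 2 ∷ []
table[5,1,3] 1 0 = u 1 0 ─ v 1 0 ↦ # 4 ∷ u 1 0 ─ u 2 0 ↦ # 1 ∷ v 1 0 ─ v 1 1 ↦ # 3 ∷ v 1 0 ─ v 1 4 ↦ # 2 ∷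
                   []
table[5,1,3] 1 1 = u 1 1 ─ v 1 1 ↦ # 0 ∷ u 1 1 ─ u 2 1 ↦ # 3 ∷ v 1 1 ─ v 1 2 ↦ # 4 ∷ []
table[5,1,3] 1 2 = u 1 2 ─ v 1 2 ↦ # 0 ∷ u 1 2 ─ u 2 2 ↦ # 3 ∷ v 1 2 ─ v 1 3 ↦ # 2 ∷ []
table[5,1,3] 1 3 = u 1 3 ─ v 1 3 ↦ # 4 ∷ u 1 3 ─ u 2 3 ↦ # 0 ∷ v 1 3 ─ v 1 4 ↦ # 1 ∷ []
table[5,1,3] 1 4 = u 1 4 ─ v 1 4 ↦ # 3 ∷ u 1 4 ─ u 2 4 ↦ # 4 ∷ []
table[5,1,3] 2 0 = u 2 0 ─ v 2 0 ↦ # 4 ∷ v 2 0 ─ v 2 1 ↦ # 0 ∷ v 2 0 ─ v 2 4 ↦ # 2 ∷ []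
table[5,1,3] 2 1 = u 2 1 ─ v 2 1 ↦ # 1 ∷ v 2 1 ─ v 2 2 ↦ # 3 ∷ []
table[5,1,3] 2 2 = u 2 2 ─ v 2 2 ↦ # 2 ∷ v 2 2 ─ v 2 3 ↦ # 4 ∷ []
table[5,1,3] 2 3 = u 2 3 ─ v 2 3 ↦ # 3 ∷ v 2 3 ─ v 2 4 ↦ # 1 ∷ []
table[5,1,3] 2 4 = u 2 4 ─ v 2 4 ↦ # 3 ∷ []
table[5,1,3] 3 0 = u 3 0 ─ v 3 0 ↦ # 4 ∷ u 3 0 ─ u 4 0 ↦ # 0 ∷ v 3 0 ─ v 3 1 ↦ # 1 ∷ v 3 0 ─ v 3 4 ↦ # 2 ∷
                   []
table[5,1,3] 3 1 = u 3 1 ─ v 3 1 ↦ # 4 ∷ u 3 1 ─ u 4 1 ↦ # 0 ∷ v 3 1 ─ v 3 2 ↦ # 3 ∷ []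
table[5,1,3] 3 2 = u 3 2 ─ v 3 2 ↦ # 4 ∷ u 3 2 ─ u 4 2 ↦ # 0 ∷ v 3 2 ─ v 3 3 ↦ # 2 ∷ []
table[5,1,3] 3 3 = u 3 3 ─ v 3 3 ↦ # 4 ∷ u 3 3 ─ u 4 3 ↦ # 0 ∷ v 3 3 ─ v 3 4 ↦ # 0 ∷ []
table[5,1,3] 3 4 = u 3 4 ─ v 3 4 ↦ # 3 ∷ u 3 4 ─ u 4 4 ↦ # 4 ∷ []
table[5,1,3] 4 0 = u 4 0 ─ v 4 0 ↦ # 3 ∷ v 4 0 ─ v 4 1 ↦ # 0 ∷ v 4 0 ─ v 4 4 ↦ # 4 ∷ []
table[5,1,3] 4 1 = u 4 1 ─ v 4 1 ↦ # 1 ∷ v 4 1 ─ v 4 2 ↦ # 4 ∷ []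
table[5,1,3] 4 2 = u 4 2 ─ v 4 2 ↦ # 3 ∷ v 4 2 ─ v 4 3 ↦ # 1 ∷ []
table[5,1,3] 4 3 = u 4 3 ─ v 4 3 ↦ # 3 ∷ v 4 3 ─ v 4 4 ↦ # 2 ∷ []
table[5,1,3] 4 4 = u 4 4 ─ v 4 4 ↦ # 1 ∷ []
table[5,1,3] _ _ = []

table[5,2,1] : Table
table[5,2,1] 0 0 = u 0 0 ─ v 0 0 ↦ # 0 ∷ u 0 0 ─ u 0 1 ↦ # 3 ∷ u 0 0 ─ u 0 4 ↦ # 4 ∷ u 0 0 ─ u 1 0 ↦ # 3 ∷
                   u 0 0 ─ u 2 0 ↦ # 1 ∷ v 0 0 ─ v 0 2 ↦ # 2 ∷ v 0 0 ─ v 0 3 ↦ # 3 ∷ []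
table[5,2,1] 0 1 = u 0 1 ─ v 0 1 ↦ # 1 ∷ u 0 1 ─ u 0 2 ↦ # 2 ∷ u 0 1 ─ u 1 1 ↦ # 2 ∷ u 0 1 ─ u 2 1 ↦ # 3 ∷
                   v 0 1 ─ v 0 3 ↦ # 2 ∷ v 0 1 ─ v 0 4 ↦ # 0 ∷ []
table[5,2,1] 0 2 = u 0 2 ─ v 0 2 ↦ # 4 ∷ u 0 2 ─ u 0 3 ↦ # 0 ∷ u 0 2 ─ u 1 2 ↦ # 0 ∷ u 0 2 ─ u 2 2 ↦ # 1 ∷
                   v 0 2 ─ v 0 4 ↦ # 1 ∷ []
table[5,2,1] 0 3 = u 0 3 ─ v 0 3 ↦ # 4 ∷ u 0 3 ─ u 0 4 ↦ # 1 ∷ u 0 3 ─ u 1 3 ↦ # 1 ∷ u 0 3 ─ u 2 3 ↦ # 0 ∷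
                   []
table[5,2,1] 0 4 = u 0 4 ─ v 0 4 ↦ # 3 ∷ u 0 4 ─ u 1 4 ↦ # 4 ∷ u 0 4 ─ u 2 4 ↦ # 0 ∷ []
table[5,2,1] 1 0 = u 1 0 ─ v 1 0 ↦ # 1 ∷ u 1 0 ─ u 2 0 ↦ # 2 ∷ v 1 0 ─ v 1 2 ↦ # 4 ∷ v 1 0 ─ v 1 3 ↦ # 0 ∷
                   []
table[5,2,1] 1 1 = u 1 1 ─ v 1 1 ↦ # 3 ∷ u 1 1 ─ u 2 1 ↦ # 0 ∷ v 1 1 ─ v 1 3 ↦ # 4 ∷ v 1 1 ─ v 1 4 ↦ # 1 ∷
                   []
table[5,2,1] 1 2 = u 1 2 ─ v 1 2 ↦ # 1 ∷ u 1 2 ─ u 2 2 ↦ # 3 ∷ v 1 2 ─ v 1 4 ↦ # 2 ∷ []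
table[5,2,1] 1 3 = u 1 3 ─ v 1 3 ↦ # 2 ∷ u 1 3 ─ u 2 3 ↦ # 3 ∷ []
table[5,2,1] 1 4 = u 1 4 ─ v 1 4 ↦ # 3 ∷ u 1 4 ─ u 2 4 ↦ # 2 ∷ []
table[5,2,1] 2 0 = u 2 0 ─ v 2 0 ↦ # 0 ∷ v 2 0 ─ v 2 2 ↦ # 3 ∷ v 2 0 ─ v 2 3 ↦ # 4 ∷ []
table[5,2,1] 2 1 = u 2 1 ─ v 2 1 ↦ # 1 ∷ v 2 1 ─ v 2 3 ↦ # 2 ∷ v 2 1 ─ v 2 4 ↦ # 4 ∷ []
table[5,2,1] 2 2 = u 2 2 ─ v 2 2 ↦ # 2 ∷ v 2 2 ─ v 2 4 ↦ # 0 ∷ []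
table[5,2,1] 2 3 = u 2 3 ─ v 2 3 ↦ # 1 ∷ []
table[5,2,1] 2 4 = u 2 4 ─ v 2 4 ↦ # 1 ∷ []
table[5,2,1] _ _ = []

table[5,2,2] : Table
table[5,2,2] 0 0 = u 0 0 ─ v 0 0 ↦ # 1 ∷ u 0 0 ─ u 1 0 ↦ # 4 ∷ u 0 0 ─ u 2 0 ↦ # 3 ∷ u 0 0 ─ u 3 0 ↦ # 0 ∷
                   u 0 0 ─ u 3 4 ↦ # 3 ∷ v 0 0 ─ v 0 2 ↦ # 2 ∷ v 0 0 ─ v 0 3 ↦ # 0 ∷ []
table[5,2,2] 0 1 = u 0 1 ─ v 0 1 ↦ # 2 ∷ u 0 1 ─ u 1 1 ↦ # 1 ∷ u 0 1 ─ u 2 1 ↦ # 3 ∷ u 0 1 ─ u 3 0 ↦ # 3 ∷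
                   u 0 1 ─ u 3 1 ↦ # 1 ∷ v 0 1 ─ v 0 3 ↦ # 4 ∷ v 0 1 ─ v 0 4 ↦ # 1 ∷ []
table[5,2,2] 0 2 = u 0 2 ─ v 0 2 ↦ # 4 ∷ u 0 2 ─ u 1 2 ↦ # 1 ∷ u 0 2 ─ u 2 2 ↦ # 2 ∷ u 0 2 ─ u 3 1 ↦ # 0 ∷
                   u 0 2 ─ u 3 2 ↦ # 1 ∷ v 0 2 ─ v 0 4 ↦ # 3 ∷ []
table[5,2,2] 0 3 = u 0 3 ─ v 0 3 ↦ # 2 ∷ u 0 3 ─ u 1 3 ↦ # 1 ∷ u 0 3 ─ u 2 3 ↦ # 3 ∷ u 0 3 ─ u 3 2 ↦ # 3 ∷
                   u 0 3 ─ u 3 3 ↦ # 1 ∷ []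
table[5,2,2] 0 4 = u 0 4 ─ v 0 4 ↦ # 0 ∷ u 0 4 ─ u 1 4 ↦ # 3 ∷ u 0 4 ─ u 2 4 ↦ # 4 ∷ u 0 4 ─ u 3 3 ↦ # 4 ∷
                   u 0 4 ─ u 3 4 ↦ # 1 ∷ []
table[5,2,2] 1 0 = u 1 0 ─ v 1 0 ↦ # 1 ∷ u 1 0 ─ u 2 0 ↦ # 2 ∷ v 1 0 ─ v 1 2 ↦ # 3 ∷ v 1 0 ─ v 1 3 ↦ # 0 ∷
                   []
table[5,2,2] 1 1 = u 1 1 ─ v 1 1 ↦ # 3 ∷ u 1 1 ─ u 2 1 ↦ # 0 ∷ v 1 1 ─ v 1 3 ↦ # 2 ∷ v 1 1 ─ v 1 4 ↦ # 4 ∷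
                   []
table[5,2,2] 1 2 = u 1 2 ─ v 1 2 ↦ # 4 ∷ u 1 2 ─ u 2 2 ↦ # 3 ∷ v 1 2 ─ v 1 4 ↦ # 0 ∷ []
table[5,2,2] 1 3 = u 1 3 ─ v 1 3 ↦ # 4 ∷ u 1 3 ─ u 2 3 ↦ # 0 ∷ []
table[5,2,2] 1 4 = u 1 4 ─ v 1 4 ↦ # 1 ∷ u 1 4 ─ u 2 4 ↦ # 2 ∷ []
table[5,2,2] 2 0 = u 2 0 ─ v 2 0 ↦ # 1 ∷ v 2 0 ─ v 2 2 ↦ # 4 ∷ v 2 0 ─ v 2 3 ↦ # 0 ∷ []
table[5,2,2] 2 1 = u 2 1 ─ v 2 1 ↦ # 4 ∷ v 2 1 ─ v 2 3 ↦ # 1 ∷ v 2 1 ─ v 2 4 ↦ # 3 ∷ []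
table[5,2,2] 2 2 = u 2 2 ─ v 2 2 ↦ # 0 ∷ v 2 2 ─ v 2 4 ↦ # 1 ∷ []
table[5,2,2] 2 3 = u 2 3 ─ v 2 3 ↦ # 2 ∷ []
table[5,2,2] 2 4 = u 2 4 ─ v 2 4 ↦ # 0 ∷ []
table[5,2,2] 3 0 = u 3 0 ─ v 3 0 ↦ # 2 ∷ v 3 0 ─ v 3 2 ↦ # 4 ∷ v 3 0 ─ v 3 3 ↦ # 1 ∷ []
table[5,2,2] 3 1 = u 3 1 ─ v 3 1 ↦ # 4 ∷ v 3 1 ─ v 3 3 ↦ # 3 ∷ v 3 1 ─ v 3 4 ↦ # 1 ∷ []
table[5,2,2] 3 2 = u 3 2 ─ v 3 2 ↦ # 2 ∷ v 3 2 ─ v 3 4 ↦ # 0 ∷ []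
table[5,2,2] 3 3 = u 3 3 ─ v 3 3 ↦ # 0 ∷ []
table[5,2,2] 3 4 = u 3 4 ─ v 3 4 ↦ # 2 ∷ []
table[5,2,2] _ _ = []

table[5,2,3] : Table
table[5,2,3] 0 0 = u 0 0 ─ v 0 0 ↦ # 1 ∷ u 0 0 ─ u 1 0 ↦ # 2 ∷ u 0 0 ─ u 2 0 ↦ # 4 ∷ u 0 0 ─ u 3 0 ↦ # 2 ∷
                   u 0 0 ─ u 4 4 ↦ # 0 ∷ v 0 0 ─ v 0 2 ↦ # 0 ∷ v 0 0 ─ v 0 3 ↦ # 4 ∷ []
table[5,2,3] 0 1 = u 0 1 ─ v 0 1 ↦ # 1 ∷ u 0 1 ─ u 1 1 ↦ # 2 ∷ u 0 1 ─ u 2 1 ↦ # 4 ∷ u 0 1 ─ u 3 1 ↦ # 0 ∷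
                   u 0 1 ─ u 4 0 ↦ # 4 ∷ v 0 1 ─ v 0 3 ↦ # 0 ∷ v 0 1 ─ v 0 4 ↦ # 2 ∷ []
table[5,2,3] 0 2 = u 0 2 ─ v 0 2 ↦ # 2 ∷ u 0 2 ─ u 1 2 ↦ # 0 ∷ u 0 2 ─ u 2 2 ↦ # 4 ∷ u 0 2 ─ u 3 2 ↦ # 1 ∷
                   u 0 2 ─ u 4 1 ↦ # 4 ∷ v 0 2 ─ v 0 4 ↦ # 3 ∷ []
table[5,2,3] 0 3 = u 0 3 ─ v 0 3 ↦ # 3 ∷ u 0 3 ─ u 1 3 ↦ # 2 ∷ u 0 3 ─ u 2 3 ↦ # 4 ∷ u 0 3 ─ u 3 3 ↦ # 2 ∷
                   u 0 3 ─ u 4 2 ↦ # 1 ∷ []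
table[5,2,3] 0 4 = u 0 4 ─ v 0 4 ↦ # 0 ∷ u 0 4 ─ u 1 4 ↦ # 4 ∷ u 0 4 ─ u 2 4 ↦ # 1 ∷ u 0 4 ─ u 3 4 ↦ # 4 ∷
                   u 0 4 ─ u 4 3 ↦ # 1 ∷ []
table[5,2,3] 1 0 = u 1 0 ─ v 1 0 ↦ # 3 ∷ u 1 0 ─ u 2 0 ↦ # 0 ∷ v 1 0 ─ v 1 2 ↦ # 1 ∷ v 1 0 ─ v 1 3 ↦ # 4 ∷
                   []
table[5,2,3] 1 1 = u 1 1 ─ v 1 1 ↦ # 4 ∷ u 1 1 ─ u 2 1 ↦ # 3 ∷ v 1 1 ─ v 1 3 ↦ # 0 ∷ v 1 1 ─ v 1 4 ↦ # 1 ∷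
                   []
table[5,2,3] 1 2 = u 1 2 ─ v 1 2 ↦ # 4 ∷ u 1 2 ─ u 2 2 ↦ # 3 ∷ v 1 2 ─ v 1 4 ↦ # 2 ∷ []
table[5,2,3] 1 3 = u 1 3 ─ v 1 3 ↦ # 3 ∷ u 1 3 ─ u 2 3 ↦ # 1 ∷ []
table[5,2,3] 1 4 = u 1 4 ─ v 1 4 ↦ # 0 ∷ u 1 4 ─ u 2 4 ↦ # 2 ∷ []
table[5,2,3] 2 0 = u 2 0 ─ v 2 0 ↦ # 3 ∷ v 2 0 ─ v 2 2 ↦ # 1 ∷ v 2 0 ─ v 2 3 ↦ # 4 ∷ []
table[5,2,3] 2 1 = u 2 1 ─ v 2 1 ↦ # 1 ∷ v 2 1 ─ v 2 3 ↦ # 2 ∷ v 2 1 ─ v 2 4 ↦ # 0 ∷ []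
table[5,2,3] 2 2 = u 2 2 ─ v 2 2 ↦ # 2 ∷ v 2 2 ─ v 2 4 ↦ # 3 ∷ []
table[5,2,3] 2 3 = u 2 3 ─ v 2 3 ↦ # 0 ∷ []
table[5,2,3] 2 4 = u 2 4 ─ v 2 4 ↦ # 4 ∷ []
table[5,2,3] 3 0 = u 3 0 ─ v 3 0 ↦ # 0 ∷ u 3 0 ─ u 4 0 ↦ # 1 ∷ v 3 0 ─ v 3 2 ↦ # 3 ∷ v 3 0 ─ v 3 3 ↦ # 4 ∷
                   []
table[5,2,3] 3 1 = u 3 1 ─ v 3 1 ↦ # 4 ∷ u 3 1 ─ u 4 1 ↦ # 3 ∷ v 3 1 ─ v 3 3 ↦ # 2 ∷ v 3 1 ─ v 3 4 ↦ # 1 ∷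
                   []
table[5,2,3] 3 2 = u 3 2 ─ v 3 2 ↦ # 4 ∷ u 3 2 ─ u 4 2 ↦ # 0 ∷ v 3 2 ─ v 3 4 ↦ # 0 ∷ []
table[5,2,3] 3 3 = u 3 3 ─ v 3 3 ↦ # 0 ∷ u 3 3 ─ u 4 3 ↦ # 3 ∷ []
table[5,2,3] 3 4 = u 3 4 ─ v 3 4 ↦ # 2 ∷ u 3 4 ─ u 4 4 ↦ # 3 ∷ []
table[5,2,3] 4 0 = u 4 0 ─ v 4 0 ↦ # 3 ∷ v 4 0 ─ v 4 2 ↦ # 2 ∷ v 4 0 ─ v 4 3 ↦ # 0 ∷ []
table[5,2,3] 4 1 = u 4 1 ─ v 4 1 ↦ # 2 ∷ v 4 1 ─ v 4 3 ↦ # 3 ∷ v 4 1 ─ v 4 4 ↦ # 1 ∷ []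
table[5,2,3] 4 2 = u 4 2 ─ v 4 2 ↦ # 3 ∷ v 4 2 ─ v 4 4 ↦ # 0 ∷ []
table[5,2,3] 4 3 = u 4 3 ─ v 4 3 ↦ # 4 ∷ []
table[5,2,3] 4 4 = u 4 4 ─ v 4 4 ↦ # 4 ∷ []
table[5,2,3] _ _ = []

data Ratio : ℕ → ℕ → Set where
  2∶1 : Ratio 2 1
  5∶1 : Ratio 5 1
  5∶2 : Ratio 5 2

ratio : ∀ {q} s → q ≡ 2 ⊎ q ≡ 5 → 1 ≤ s → 2 * s ≤ q → Ratio q s
ratio 1 (inj₁ refl) _ _ = 2∶1
ratio 1 (inj₂ refl) _ _ = 5∶1
ratio 2 (inj₂ refl) _ _ = 5∶2
ratio 2 (inj₁ refl) _ (s≤s (s≤s ()))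
ratio (suc (suc (suc s))) (inj₁ refl) _ 2s≤2 =
  contradiction (≤-trans (*-monoʳ-≤ 2 (m≤m+n 3 s)) 2s≤2) (toWitnessFalse {a? = 6 ≤? 2} tt)
ratio (suc (suc (suc s))) (inj₂ refl) _ 2s≤5 =
  contradiction (≤-trans (*-monoʳ-≤ 2 (m≤m+n 3 s)) 2s≤5) (toWitnessFalse {a? = 6 ≤? 5} tt)

blocks-and-tail : ∀ g .{{_ : NonZero g}} → ∃[ l ] ∃[ a ] l < 3 × g ≡ a * 3 + suc l
blocks-and-tail 1 = 0 , 0 , s≤s z≤n , refl
blocks-and-tail 2 = 1 , 0 , s≤s (s≤s z≤n) , refl
blocks-and-tail 3 = 2 , 0 , s≤s (s≤s (s≤s z≤n)) , refl
blocks-and-tail (suc (suc (suc (suc g)))) with blocks-and-tail (suc g)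
... | l , a , l<3 , eq = l , suc a , l<3 , cong (3 +_) eq

star-colorable-from : ∀ q s l a .{{_ : NonZero q}} → s ≤ q → (table : Table) →
  True (Quotient.certificate? q s l (coloring table)) →
  StarEdgeColorable (GP (q * (a * 3 + suc l)) (s * (a * 3 + suc l))) 5
star-colorable-from q s l a s≤q table certified =
  Pullback.star-colorable q s l a s≤q (coloring table) (toWitness certified)

colorable : ∀ {q s} → Ratio q s → ∀ l a → l < 3 →
            StarEdgeColorable (GP (q * (a * 3 + suc l)) (s * (a * 3 + suc l))) 5
colorable 2∶1 0 a _ = star-colorable-from 2 1 0 a (s≤s z≤n) table[2,1,1] tt
colorable 2∶1 1 a _ = star-colorable-from 2 1 1 a (s≤s z≤n) table[2,1,2] tt
colorable 2∶1 2 a _ = star-colorable-from 2 1 2 a (s≤s z≤n) table[2,1,3] tt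
colorable 5∶1 0 a _ = star-colorable-from 5 1 0 a (s≤s z≤n) table[5,1,1] tt
colorable 5∶1 1 a _ = star-colorable-from 5 1 1 a (s≤s z≤n) table[5,1,2] tt
colorable 5∶1 2 a _ = star-colorable-from 5 1 2 a (s≤s z≤n) table[5,1,3] tt
colorable 5∶2 0 a _ = star-colorable-from 5 2 0 a (s≤s (s≤s z≤n)) table[5,2,1] tt
colorable 5∶2 1 a _ = star-colorable-from 5 2 1 a (s≤s (s≤s z≤n)) table[5,2,2] tt
colorable 5∶2 2 a _ = star-colorable-from 5 2 2 a (s≤s (s≤s z≤n)) table[5,2,3] tt
colorable _   (suc (suc (suc _))) _ (s≤s (s≤s (s≤s ())))

colorable-multiple : ∀ q s g → q ≡ 2 ⊎ q ≡ 5 → 1 ≤ s * g → 2 * (s * g) ≤ q * g →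
                     StarEdgeColorable (GP (q * g) (s * g)) 5
colorable-multiple q s g q≡2∨5 1≤sg 2sg≤qg = from-shape (blocks-and-tail g)
  where
  instance
    sg≢0 : NonZero (s * g)
    sg≢0 = >-nonZero 1≤sg
    g≢0 : NonZero g
    g≢0 = m*n≢0⇒n≢0 s
  1≤s : 1 ≤ s
  1≤s = >-nonZero⁻¹ s {{m*n≢0⇒m≢0 s}}
  2s≤q : 2 * s ≤ q
  2s≤q = *-cancelʳ-≤ (2 * s) q g (subst (_≤ q * g) (sym (*-assoc 2 s g)) 2sg≤qg)
  from-shape : ∃[ l ] ∃[ a ] l < 3 × g ≡ a * 3 + suc l → StarEdgeColorable (GP (q * g) (s * g)) 5
  from-shape (l , a , l<3 , g≡) =
    subst (λ g → StarEdgeColorable (GP (q * g) (s * g)) 5) (sym g≡)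
          (colorable (ratio s q≡2∨5 1≤s 2s≤q) l a l<3)

lemma5 : (n k : ℕ) → 1 ≤ k → 2 * k ≤ n →
         (n ≡ 2 * gcd n k ⊎ n ≡ 5 * gcd n k) →
         StarEdgeColorable (GP n k) 5
lemma5 n k 1≤k 2k≤n n≡qg with gcd n k | gcd[m,n]∣n n k
... | g | divides s refl with n≡qg
...   | inj₁ refl = colorable-multiple 2 s g (inj₁ refl) 1≤k 2k≤n
...   | inj₂ refl = colorable-multiple 5 s g (inj₂ refl) 1≤k 2k≤n
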